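{- Let $m = 3\cdot 7\cdot 13\cdot 19\cdot 31\cdot 37\cdot 73\cdot 313\cdot 601\cdot 5167\cdot 390001$, and let $\alpha$ be a positive integer with $\alpha \equiv 5 \pmod{m}$. For $n\ge 0$ let $U_n(\alpha,1) = \frac{\alpha^n-1}{\alpha-1}$. Then there exist infinitely many positive integers $k$ such that \[k^2\left(U_n(\alpha,1) + (\alpha-1)^2\right) + 1\] is composite for all integers $n \ge 1$.
   Context: $U_n(\alpha,1) = 1+\alpha+\cdots+\alpha^{n-1}$ is the Lucas sequence of the first kind associated with the pair $(\alpha,1)$. -}

module Defs where

open import Data.Nat using (ℕ; zero; suc; _+_; _*_; _^_)

modulus : ℕ
modulus = 3 * 7 * 13 * 19 * 31 * 37 * 73 * 313 * 601 * 5167 * 390001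

-- Lucas sequence U_n(α,1) = 1 + α + ⋯ + α^(n-1) = (α^n - 1)/(α - 1)
U : ℕ → ℕ → ℕ
U zero    α = 0
U (suc n) α = α ^ n + U n α

{-# OPTIONS --safe #-}
-- Modulo every prime p ∣ m, 5 has order dividing 72 and p ∣ U₇₂(5), so for α ≡ 5 (mod m)
-- the sequence U_n(α) mod p only depends on n mod 72.  The eleven primes cover the residues:
-- for each r < 72 one of them divides K₀²(U_r(5) + 4²) + 1.  Hence if k ≡ K₀ (mod m) and
-- k ≥ m, every k²(U_n(α) + (α − 1)²) + 1 has a divisor p with 1 < p ≤ m ≤ k < itself.
module Submission where

open import Defs
open import Data.Nat using (ℕ; _+_; _*_; _^_; _∸_; _<_; _≤_; _%_)
open import Data.Nat.Primality using (Composite)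
open import Data.Product using (∃-syntax; _×_)
open import Relation.Binary.PropositionalEquality using (_≡_)

open import Data.Nat.Base using (zero; suc; NonZero; >-nonZero; _/_; z≤n; s≤s; n>1⇒nonTrivial)
open import Data.Nat.Properties
open import Data.Nat.DivMod
  using (m≡m%n+[m/n]*n; m%n<n; [m+kn]%n≡m%n; %-distribˡ-+; %-distribˡ-*; m∣n⇒o%n%m≡o%m; _mod_)
open import Data.Nat.Divisibility using (_∣_; _∣?_; m%n≡0⇒n∣m; n∣m⇒m%n≡0; ∣⇒≤)
open import Data.Nat.Primality using (composite)
open import Data.Fin using (Fin; toℕ)
open import Data.Fin.Properties using (all?; toℕ-fromℕ<)
open import Data.List.Base using (List; []; _∷_)
open import Data.List.Relation.Unary.Any using (Any; any?; satisfied)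
open import Data.Product using (_,_)
open import Relation.Nullary.Decidable using (Dec; _×-dec_; toWitness)
open import Relation.Binary.PropositionalEquality
  using (refl; sym; trans; cong; cong₂; module ≡-Reasoning)

open ≡-Reasoning

U-+ : ∀ m n a → U (m + n) a ≡ U n a + a ^ n * U m a
U-+ zero    n a = sym (trans (cong (U n a +_) (*-zeroʳ (a ^ n))) (+-identityʳ (U n a)))
U-+ (suc m) n a = begin
  a ^ (m + n) + U (m + n) a             ≡⟨ cong₂ _+_ (^-distribˡ-+-* a m n) (U-+ m n a) ⟩
  a ^ m * a ^ n + (U n a + a ^ n * U m a) ≡⟨ +-rearrange ⟩
  U n a + (a ^ m * a ^ n + a ^ n * U m a) ≡⟨ cong (λ x → U n a + (x + a ^ n * U m a)) (*-comm (a ^ m) (a ^ n)) ⟩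
  U n a + (a ^ n * a ^ m + a ^ n * U m a) ≡⟨ cong (U n a +_) (sym (*-distribˡ-+ (a ^ n) (a ^ m) (U m a))) ⟩
  U n a + a ^ n * (a ^ m + U m a)        ∎
  where
  +-rearrange : a ^ m * a ^ n + (U n a + a ^ n * U m a) ≡ U n a + (a ^ m * a ^ n + a ^ n * U m a)
  +-rearrange = trans (sym (+-assoc (a ^ m * a ^ n) (U n a) _))
    (trans (cong (_+ a ^ n * U m a) (+-comm (a ^ m * a ^ n) (U n a))) (+-assoc (U n a) _ _))

F : ℕ → ℕ → ℕ → ℕ
F α k n = k ^ 2 * (U n α + (α ∸ 1) ^ 2) + 1

module Congruence (m : ℕ) .{{_ : NonZero m}} where

  infix 4 _≋_
  _≋_ : ℕ → ℕ → Set
  a ≋ b = a % m ≡ b % m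

  +-cong : ∀ {a a′ b b′} → a ≋ a′ → b ≋ b′ → a + b ≋ a′ + b′
  +-cong {a} {a′} {b} {b′} a≋a′ b≋b′ = begin
    (a + b) % m               ≡⟨ %-distribˡ-+ a b m ⟩
    (a % m + b % m) % m       ≡⟨ cong₂ (λ x y → (x + y) % m) a≋a′ b≋b′ ⟩
    (a′ % m + b′ % m) % m     ≡⟨ sym (%-distribˡ-+ a′ b′ m) ⟩
    (a′ + b′) % m             ∎

  *-cong : ∀ {a a′ b b′} → a ≋ a′ → b ≋ b′ → a * b ≋ a′ * b′
  *-cong {a} {a′} {b} {b′} a≋a′ b≋b′ = begin
    (a * b) % m               ≡⟨ %-distribˡ-* a b m ⟩
    (a % m * (b % m)) % m     ≡⟨ cong₂ (λ x y → (x * y) % m) a≋a′ b≋b′ ⟩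
    (a′ % m * (b′ % m)) % m   ≡⟨ sym (%-distribˡ-* a′ b′ m) ⟩
    (a′ * b′) % m             ∎

  ^-cong : ∀ {a a′} n → a ≋ a′ → a ^ n ≋ a′ ^ n
  ^-cong zero    a≋a′ = refl
  ^-cong (suc n) a≋a′ = *-cong a≋a′ (^-cong n a≋a′)

  U-cong : ∀ {a a′} n → a ≋ a′ → U n a ≋ U n a′
  U-cong zero    a≋a′ = refl
  U-cong (suc n) a≋a′ = +-cong (^-cong n a≋a′) (U-cong n a≋a′)

  pred-cong : ∀ {a r} → a % m ≡ suc r → a ∸ 1 ≋ r
  pred-cong {a} {r} a%m≡1+r = begin
    (a ∸ 1) % m                        ≡⟨ cong (λ x → (x ∸ 1) % m) (m≡m%n+[m/n]*n a m) ⟩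
    (a % m + a / m * m ∸ 1) % m        ≡⟨ cong (λ x → (x + a / m * m ∸ 1) % m) a%m≡1+r ⟩
    (r + a / m * m) % m                ≡⟨ [m+kn]%n≡m%n r (a / m) m ⟩
    r % m                              ∎

  module _ {a d : ℕ} .{{_ : NonZero d}} (aᵈ≋1 : a ^ d ≋ 1) (Uᵈ≋0 : U d a ≋ 0) where

    U-shift : ∀ r → U (r + d) a ≋ U r a
    U-shift r = begin
      U (r + d) a % m               ≡⟨ cong (_% m) (U-+ r d a) ⟩
      (U d a + a ^ d * U r a) % m   ≡⟨ +-cong Uᵈ≋0 (*-cong aᵈ≋1 refl) ⟩
      (1 * U r a) % m               ≡⟨ cong (_% m) (*-identityˡ (U r a)) ⟩
      U r a % m                     ∎

    U-+-multiple : ∀ r q → U (r + q * d) a ≋ U r a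
    U-+-multiple r zero    = cong (λ x → U x a % m) (+-identityʳ r)
    U-+-multiple r (suc q) = begin
      U (r + (d + q * d)) a % m   ≡⟨ cong (λ x → U x a % m) reassoc ⟩
      U (r + q * d + d) a % m     ≡⟨ U-shift (r + q * d) ⟩
      U (r + q * d) a % m         ≡⟨ U-+-multiple r q ⟩
      U r a % m                   ∎
      where
      reassoc : r + (d + q * d) ≡ r + q * d + d
      reassoc = trans (cong (r +_) (+-comm d (q * d))) (sym (+-assoc r (q * d) d))

    U-periodic : ∀ n → U n a ≋ U (n % d) a
    U-periodic n = trans (cong (λ x → U x a % m) (m≡m%n+[m/n]*n n d)) (U-+-multiple (n % d) (n / d))

  F-cong : ∀ {α α′ k k′} n → α ≋ α′ → α ∸ 1 ≋ α′ ∸ 1 → k ≋ k′ → F α k n ≋ F α′ k′ n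
  F-cong n α≋α′ α-1≋α′-1 k≋k′ =
    +-cong (*-cong (^-cong 2 k≋k′) (+-cong (U-cong n α≋α′) (^-cong 2 α-1≋α′-1))) refl

  F-periodic : ∀ {α k d} .{{_ : NonZero d}} → α ^ d ≋ 1 → U d α ≋ 0 → ∀ n → F α k n ≋ F α k (n % d)
  F-periodic {k = k} αᵈ≋1 Uᵈ≋0 n =
    +-cong (*-cong {k ^ 2} refl (+-cong (U-periodic αᵈ≋1 Uᵈ≋0 n) refl)) refl

%-cong-divisor : ∀ {p m a b} .{{_ : NonZero p}} .{{_ : NonZero m}} → p ∣ m → a % m ≡ b % m → a % p ≡ b % p
%-cong-divisor {p} {m} {a} {b} p∣m a≋b = begin
  a % p       ≡⟨ sym (m∣n⇒o%n%m≡o%m p m a p∣m) ⟩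
  a % m % p   ≡⟨ cong (_% p) a≋b ⟩
  b % m % p   ≡⟨ m∣n⇒o%n%m≡o%m p m b p∣m ⟩
  b % p       ∎

U-positive : ∀ {a} n → 1 ≤ a → 1 ≤ U (suc n) a
U-positive {suc a} n _ = ≤-trans (m^n>0 (suc a) n) (m≤m+n (suc a ^ n) (U n (suc a)))

k<F : ∀ {α} k n → 1 ≤ α → 1 ≤ n → k < F α k n
k<F zero    n       _   _ = s≤s z≤n
k<F {α} (suc k) (suc n) 1≤α _ =
  ≤-<-trans (≤-trans (m≤m*n (suc k) (suc k * 1)) (m≤m*n (suc k ^ 2) X {{>-nonZero X-positive}}))
            (m<m+n (suc k ^ 2 * X) (s≤s z≤n))
  where
  X = U (suc n) α + (α ∸ 1) ^ 2
  X-positive : 0 < X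
  X-positive = ≤-trans (U-positive n 1≤α) (m≤m+n (U (suc n) α) ((α ∸ 1) ^ 2))

divisor-of-F⇒composite : ∀ {α k n p} → 1 ≤ α → 1 ≤ n → 1 < p → p ≤ k → p ∣ F α k n → Composite (F α k n)
divisor-of-F⇒composite {k = k} {n} 1≤α 1≤n 1<p p≤k p∣F =
  composite (≤-<-trans p≤k (k<F k n 1≤α 1≤n)) p∣F
  where instance _ = n>1⇒nonTrivial 1<p

CoveringDivisor : ℕ → ℕ → ℕ → ℕ → ℕ → Set
CoveringDivisor M a K r p = 1 < p × p ∣ M × p ∣ F a K r

-- The conclusion is F α k n unfolded: converting F α k n to it for a concrete
-- numeral k makes Agda normalise the numeral.
covering⇒composite : ∀ {M K a d α k} .{{_ : NonZero M}} .{{_ : NonZero d}} →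
  a ^ d % M ≡ 1 % M → U d a % M ≡ 0 % M →
  ((r : Fin d) → ∃[ p ] CoveringDivisor M a K (toℕ r) p) →
  1 ≤ α → α % M ≡ a % M → (α ∸ 1) % M ≡ (a ∸ 1) % M →
  M ≤ k → k % M ≡ K % M → ∀ n → 1 ≤ n → Composite (k ^ 2 * (U n α + (α ∸ 1) ^ 2) + 1)
covering⇒composite {M} {K} {a} {d} {α} {k} aᵈ≋1 Uᵈ≋0 covering 1≤α α≋a α-1≋a-1 M≤k k≋K n 1≤n
  with covering (n mod d)
... | p , 1<p , p∣M , p∣Fᵣ = divisor-of-F⇒composite 1≤α 1≤n 1<p (≤-trans (∣⇒≤ p∣M) M≤k) p∣F
  where
  open Congruence M
  instance _ = >-nonZero (<-trans (s≤s z≤n) 1<p)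
  F-reduces : F α k n ≋ F a K (n % d)
  F-reduces = trans (F-cong n α≋a α-1≋a-1 k≋K) (F-periodic {k = K} aᵈ≋1 Uᵈ≋0 n)
  p∣F : p ∣ F α k n
  p∣F = m%n≡0⇒n∣m _ p (begin
    F α k n % p                ≡⟨ %-cong-divisor p∣M F-reduces ⟩
    F a K (n % d) % p          ≡⟨ cong (λ r → F a K r % p) (sym (toℕ-fromℕ< (m%n<n n d))) ⟩
    F a K (toℕ (n mod d)) % p  ≡⟨ n∣m⇒m%n≡0 _ p p∣Fᵣ ⟩
    0                          ∎)

-- A Chinese-remainder solution of the covering congruences; `covering` certifies it.
K₀ : ℕ
K₀ = 94009529046945278533210

5^72≡1[mod-modulus] : 5 ^ 72 % modulus ≡ 1 % modulus
5^72≡1[mod-modulus] = refl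

U72≡0[mod-modulus] : U 72 5 % modulus ≡ 0 % modulus
U72≡0[mod-modulus] = refl

primeFactors : List ℕ
primeFactors = 3 ∷ 7 ∷ 13 ∷ 19 ∷ 31 ∷ 37 ∷ 73 ∷ 313 ∷ 601 ∷ 5167 ∷ 390001 ∷ []

covering : (r : Fin 72) → ∃[ p ] CoveringDivisor modulus 5 K₀ (toℕ r) p
covering r = satisfied (toWitness {a? = all? covered?} _ r)
  where
  covered? : (r : Fin 72) → Dec (Any (CoveringDivisor modulus 5 K₀ (toℕ r)) primeFactors)
  covered? r = any? (λ p → 1 <? p ×-dec p ∣? modulus ×-dec p ∣? F 5 K₀ (toℕ r)) primeFactors

-- The implicit arguments of covering⇒composite are given because inferring them by
-- unification normalises the numerals K₀ and modulus.
theorem5p1 : (α : ℕ) → 1 ≤ α → α % modulus ≡ 5 →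
    (N : ℕ) → ∃[ k ] (N < k × ((n : ℕ) → 1 ≤ n →
    Composite (k ^ 2 * (U n α + (α ∸ 1) ^ 2) + 1)))
theorem5p1 α 1≤α α%m≡5 N =
  K₀ + suc N * modulus ,
  ≤-trans (m≤m*n (suc N) modulus) (m≤n+m (suc N * modulus) K₀) ,
  covering⇒composite {modulus} {K₀} {5} {72} {α} {K₀ + suc N * modulus}
    5^72≡1[mod-modulus] U72≡0[mod-modulus] covering
    1≤α α%m≡5 (Congruence.pred-cong modulus {α} α%m≡5)
    (≤-trans (m≤n*m modulus (suc N)) (m≤n+m (suc N * modulus) K₀))
    ([m+kn]%n≡m%n K₀ (suc N) modulus)
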